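{- For every integer $n\ge0$, $$(x)_{n,q,t}=\sum_{k=0}^n s_{q,t}[n,k]\,x^k\qquad\text{and}\qquad x^n=\sum_{k=0}^nS_{q,t}[n,k]\,(x)_{k,q,t},$$ where $(x)_{k,q,t}=\prod_{j=0}^{k-1}(x-[j]_{q,t})$.
   Context: $q,t,x$ are indeterminates. $[0]_{q,t}=0$; for even $k\ge2$, $[k]_{q,t}=(1+q^2+\dots+q^{k-2})\,t$; for odd $k\ge1$, $[k]_{q,t}=q^{k-1}+(1+q^2+\dots+q^{k-3})\,t$. RG-words: $\mathcal R(n,k)$ is the set of words $w=w_1\cdots w_n$ of positive integers with $w_1=1$, $w_i\le\max(w_1,\dots,w_{i-1})+1$, $\max_iw_i=k$; $\mathcal A(n,k)$ is the subset in which each even letter occurs exactly once. With $m_i=\max(w_1,\dots,w_i)$, $A(w)=\sum_{i\ge2}A_i(w)$ where $A_i(w)=w_i-1$ if $m_{i-1}\ge w_i$ and $0$ otherwise, and $B(w)=\#\{i\ge2:m_{i-1}>w_i\}$. For $n\ge1$, $1\le k\le n$: $S_{q,t}[n,k]=\sum_{w\in\mathcal A(n,k)}q^{A(w)}t^{B(w)}$; $S_{q,t}[n,0]=\delta_{n,0}$; $S_{q,t}[n,k]=0$ for $k>n$. Rooks: the staircase board of length $n$ has squares $(i,j)$, $i,j\ge1$, $i+j\le n$ (row $i$ from top); $(i,j)$ has $n-i-j$ squares below it and is shaded if $n-i-j$ is even. $\mathcal{AR}(n,r)$ is the set of placements of $r$ rooks on shaded squares, no two in the same column; $\mathrm{below}(T)$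 is the total number of squares below rooks, $\mathrm{nrow}(T)$ the number of rooks not in row $1$. For $n\ge1$, $0\le k\le n$: $s_{q,t}[n,k]=(-1)^{n-k}\sum_{T\in\mathcal{AR}(n,n-k)}q^{\mathrm{below}(T)}t^{\mathrm{nrow}(T)}$; $s_{q,t}[0,0]=1$; $s_{q,t}[n,k]=0$ for $k>n$. -}

module Defs where

open import Level using (Level)
open import Data.Bool using (Bool; true; false; if_then_else_; _∧_; _∨_; not)
open import Data.Nat using (ℕ; zero; suc) renaming (_+_ to _+ℕ_)
open import Data.Nat using ( _∸_; _⊔_; _≡ᵇ_; _<ᵇ_; _≤ᵇ_; _%_; _/_)
open import Data.List using (List; []; _∷_; map; concatMap; upTo; length; foldr)
open import Data.Product using (_×_; _,_)
open import Algebra.Bundles using (CommutativeRing)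

isEven : ℕ → Bool
isEven n = n % 2 ≡ᵇ 0

oneTo : ℕ → List ℕ
oneTo n = map suc (upTo n)

-- all continuations of length r of an RG-word whose current maximum is m
rgGo : ℕ → ℕ → List (List ℕ)
rgGo zero    m = [] ∷ []
rgGo (suc r) m = concatMap (λ a → map (a ∷_) (rgGo r (m ⊔ a))) (oneTo (suc m))

-- all RG-words of length n (w₁ = 1, wᵢ ≤ max(w₁..wᵢ₋₁) + 1)
rgWords : ℕ → List (List ℕ)
rgWords zero    = [] ∷ []
rgWords (suc n) = map (1 ∷_) (rgGo n 1)

maxL : List ℕ → ℕ
maxL = foldr _⊔_ 0

count : ℕ → List ℕ → ℕ
count e []      = 0
count e (a ∷ w) = (if a ≡ᵇ e then 1 else 0) +ℕ count e w

inA : ℕ → List ℕ → Bool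
inA k w = (maxL w ≡ᵇ k) ∧ foldr (λ e b → (not (isEven e) ∨ (count e w ≡ᵇ 1)) ∧ b) true (oneTo k)

-- A-statistic on the suffix w₂…wₙ, given the current prefix maximum m
statAGo : ℕ → List ℕ → ℕ
statAGo m []      = 0
statAGo m (a ∷ w) = (if a ≤ᵇ m then a ∸ 1 else 0) +ℕ statAGo (m ⊔ a) w

statBGo : ℕ → List ℕ → ℕ
statBGo m []      = 0
statBGo m (a ∷ w) = (if a <ᵇ m then 1 else 0) +ℕ statBGo (m ⊔ a) w

statA : List ℕ → ℕ
statA []      = 0
statA (a ∷ w) = statAGo a w

statB : List ℕ → ℕ
statB []      = 0
statB (a ∷ w) = statBGo a w

-- rooks: a rook is a square (i , j) = (row , column)
-- shaded rows of column j on the staircase board of length n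
shadedRows : ℕ → ℕ → List ℕ
shadedRows n j = foldr (λ i l → if isEven (n ∸ i ∸ j) then i ∷ l else l) [] (oneTo (n ∸ j))

placeCols : ℕ → List ℕ → List (List (ℕ × ℕ))
placeCols n []       = [] ∷ []
placeCols n (j ∷ js) =
  concatMap (λ rest → rest ∷ map (λ i → (i , j) ∷ rest) (shadedRows n j)) (placeCols n js)

placements : ℕ → List (List (ℕ × ℕ))
placements n = placeCols n (oneTo n)

below : ℕ → List (ℕ × ℕ) → ℕ
below n []            = 0
below n ((i , j) ∷ T) = (n ∸ i ∸ j) +ℕ below n T

nrow : List (ℕ × ℕ) → ℕ
nrow []            = 0
nrow ((i , j) ∷ T) = (if i ≡ᵇ 1 then 0 else 1) +ℕ nrow T

-- Ring-valued part: q, t (and x) are elements of an arbitrary commutative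
-- ring; an identity holding for all such is exactly an identity in ℤ[q,t,x].

module QT {c ℓ : Level} (R : CommutativeRing c ℓ) where
  open CommutativeRing R

  pow : Carrier → ℕ → Carrier
  pow y zero    = 1#
  pow y (suc n) = y * pow y n

  sumTo : ℕ → (ℕ → Carrier) → Carrier
  sumTo zero    f = f 0
  sumTo (suc n) f = sumTo n f + f (suc n)

  sumList : {A : Set} → (A → Carrier) → List A → Carrier
  sumList f = foldr (λ a r → f a + r) 0#

  module _ (q t : Carrier) where

    geo : ℕ → Carrier
    geo zero    = 0#
    geo (suc m) = geo m + pow q (2 Data.Nat.* m)

    qtInt : ℕ → Carrier
    qtInt k = if k ≡ᵇ 0 then 0#
              else if isEven k then geo (k / 2) * t
              else pow q (k ∸ 1) + geo (k / 2) * t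

    falling : Carrier → ℕ → Carrier
    falling x zero    = 1#
    falling x (suc k) = falling x k * (x - qtInt k)

    Sqt : ℕ → ℕ → Carrier
    Sqt zero    k = if k ≡ᵇ 0 then 1# else 0#
    Sqt (suc n) k =
      if k ≡ᵇ 0 then 0#
      else if k ≤ᵇ suc n
        then sumList (λ w → if inA k w then pow q (statA w) * pow t (statB w) else 0#)
                     (rgWords (suc n))
        else 0#

    sqt : ℕ → ℕ → Carrier
    sqt zero    k = if k ≡ᵇ 0 then 1# else 0#
    sqt (suc n) k =
      if k ≤ᵇ suc n
        then pow (- 1#) (suc n ∸ k) *
             sumList (λ T → if length T ≡ᵇ (suc n ∸ k)
                              then pow q (below (suc n) T) * pow t (nrow T) else 0#)
                     (placements (suc n))
        else 0#

module Submission where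

open import Defs
open import Data.Nat using (ℕ)
open import Data.Product using (_×_)
open import Algebra.Bundles using (CommutativeRing)

open import Algebra.Bundles using (CommutativeMonoid)
open import Data.Bool using (Bool; true; false; if_then_else_; _∧_; _∨_; not)
import Data.Bool.Properties as BoolP
open import Data.Nat
  using (zero; suc; pred; _∸_; _⊔_; _≡ᵇ_; _<ᵇ_; _≤ᵇ_; _≤_; _<_; z≤n; s≤s; _/_; _≟_; _≤?_; _<?_)
  renaming (_+_ to _+ℕ_; _*_ to _*ℕ_)
import Data.Nat.Properties as ℕP
import Data.Nat.DivMod as DivMod
open import Data.List using (List; []; _∷_; map; concatMap; upTo; length; foldr; _++_; applyUpTo)
import Data.List.Properties as ListP
open import Data.List.Relation.Unary.All as All using (All; []; _∷_)
import Data.List.Relation.Unary.All.Properties as AllP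
open import Data.Product using (_,_; proj₂)
open import Data.Sum using (inj₁; inj₂; [_,_]′)
open import Data.Empty using (⊥-elim)
open import Relation.Nullary using (¬_; yes; no)
open import Relation.Nullary.Decidable using (dec-true; dec-false)
open import Relation.Binary.PropositionalEquality as ≡ using (_≡_; _≢_)
open import Function using (_∘_; id)
import Algebra.Solver.Ring.NaturalCoefficients.Default

-- Both identities evaluate a weighted sum of combinatorial
-- objects in two ways; the one arithmetic fact tying the objects to the
-- q,t-integers is the expansion (qtSum≈qtInt)
--     [m]_{q,t} = Σ_{i<m, i even} q^i t^{[i+1<m]}.
-- (1) Rooks.  Weight a placement T on a set of columns by
--     (-1)^|T| q^below(T) t^nrow(T) x^(#columns - |T|).  The total weight
--     factorises over the columns (rookSum-cons), column j of the staircase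
--     of length n contributing x - [n-j]_{q,t} (columnWeight≈qtInt); so the
--     total over the staircase is (x)_{n,q,t}.  Grouping placements by
--     k = n - |T| yields the first identity.
-- (2) RG-words.  For a prefix p, the weights [w ∈ 𝒜] q^A t^B (x)_{max w} of
--     all continuations w of length r sum to [p admissible] (x)_{max p} x^r
--     (continuationSum-closed): an old letter a contributes
--     [a odd] q^(a-1) t^[a<max p], in total [max p]_{q,t}, and the new letter
--     max p + 1 multiplies the falling factorial by x - [max p]_{q,t}.
--     Grouping words by k = max w yields the second identity.

≡ᵇ-true : ∀ {m n} → m ≡ n → (m ≡ᵇ n) ≡ true
≡ᵇ-true {m} {n} = dec-true (m ≟ n)

≡ᵇ-false : ∀ {m n} → m ≢ n → (m ≡ᵇ n) ≡ false
≡ᵇ-false {m} {n} = dec-false (m ≟ n)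

<ᵇ-true : ∀ {m n} → m < n → (m <ᵇ n) ≡ true
<ᵇ-true {m} {n} = dec-true (m <? n)

<ᵇ-false : ∀ {m n} → n ≤ m → (m <ᵇ n) ≡ false
<ᵇ-false {m} {n} n≤m = dec-false (m <? n) (ℕP.≤⇒≯ n≤m)

≤ᵇ-true : ∀ {m n} → m ≤ n → (m ≤ᵇ n) ≡ true
≤ᵇ-true {m} {n} = dec-true (m ≤? n)

≤ᵇ-false : ∀ {m n} → n < m → (m ≤ᵇ n) ≡ false
≤ᵇ-false {m} {n} n<m = dec-false (m ≤? n) (ℕP.<⇒≱ n<m)

-- Parity.  `isEven` steps by two definitionally; the parity view also records
-- which of m, m + 1 equals 2⌊(m+1)/2⌋, the exponent used by `geo`.

isEven-suc : ∀ n → not (isEven (suc n)) ≡ isEven n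
isEven-suc zero          = ≡.refl
isEven-suc (suc zero)    = ≡.refl
isEven-suc (suc (suc n)) = isEven-suc n

half-suc-suc : ∀ n → suc (suc n) / 2 ≡ suc (n / 2)
half-suc-suc n = DivMod.m/n≡1+[m∸n]/n {suc (suc n)} {2} (s≤s (s≤s z≤n))

double-half-step : ∀ m {k} → 2 *ℕ (suc m / 2) ≡ k → 2 *ℕ (suc (suc (suc m)) / 2) ≡ suc (suc k)
double-half-step m d = ≡.trans (≡.cong (2 *ℕ_) (half-suc-suc (suc m)))
                               (≡.trans (ℕP.*-suc 2 (suc m / 2)) (≡.cong (2 +ℕ_) d))

data Parity (m : ℕ) : Set where
  even : isEven m ≡ true  → isEven (suc m) ≡ false → 2 *ℕ (suc m / 2) ≡ m     → Parity m
  odd  : isEven m ≡ false → isEven (suc m) ≡ true  → 2 *ℕ (suc m / 2) ≡ suc m → Parity m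

parity : ∀ m → Parity m
parity zero          = even ≡.refl ≡.refl ≡.refl
parity (suc zero)    = odd ≡.refl ≡.refl ≡.refl
parity (suc (suc m)) with parity m
... | even e o d = even e o (double-half-step m d)
... | odd  e o d = odd  e o (double-half-step m d)

module FiniteFold {c ℓ} (M : CommutativeMonoid c ℓ) where
  open CommutativeMonoid M
  open import Relation.Binary.Reasoning.Setoid setoid

  big : ℕ → (ℕ → Carrier) → Carrier
  big zero    f = ε
  big (suc n) f = big n f ∙ f n

  big-cong : ∀ n {f g} → (∀ i → i < n → f i ≈ g i) → big n f ≈ big n g
  big-cong zero    f≈g = refl
  big-cong (suc n) f≈g = ∙-cong (big-cong n (λ i i<n → f≈g i (ℕP.m<n⇒m<1+n i<n))) (f≈g n ℕP.≤-refl)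

  big-peel : ∀ n f → big (suc n) f ≈ f 0 ∙ big n (f ∘ suc)
  big-peel zero    f = trans (identityˡ (f 0)) (sym (identityʳ (f 0)))
  big-peel (suc n) f = begin
    big (suc n) f ∙ f (suc n)           ≈⟨ ∙-congʳ (big-peel n f) ⟩
    (f 0 ∙ big n (f ∘ suc)) ∙ f (suc n) ≈⟨ assoc _ _ _ ⟩
    f 0 ∙ (big n (f ∘ suc) ∙ f (suc n)) ∎

  big-reverse : ∀ n f → big n f ≈ big n (λ i → f (n ∸ suc i))
  big-reverse zero    f = refl
  big-reverse (suc n) f = begin
    big n f ∙ f n                     ≈⟨ ∙-congʳ (big-reverse n f) ⟩
    big n (λ i → f (n ∸ suc i)) ∙ f n ≈⟨ comm _ _ ⟩
    f n ∙ big n (λ i → f (n ∸ suc i)) ≈⟨ big-peel n (λ i → f (suc n ∸ suc i)) ⟨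
    big (suc n) (λ i → f (suc n ∸ suc i)) ∎

  big-ε : ∀ n {f} → (∀ i → i < n → f i ≈ ε) → big n f ≈ ε
  big-ε zero    f≈ε = refl
  big-ε (suc n) f≈ε =
    trans (∙-cong (big-ε n (λ i i<n → f≈ε i (ℕP.m<n⇒m<1+n i<n))) (f≈ε n ℕP.≤-refl)) (identityˡ ε)

  big-∙ : ∀ n f g → big n (λ i → f i ∙ g i) ≈ big n f ∙ big n g
  big-∙ zero    f g = sym (identityˡ ε)
  big-∙ (suc n) f g = begin
    big n (λ i → f i ∙ g i) ∙ (f n ∙ g n) ≈⟨ ∙-congʳ (big-∙ n f g) ⟩
    (big n f ∙ big n g) ∙ (f n ∙ g n)     ≈⟨ interchange ⟩
    (big n f ∙ f n) ∙ (big n g ∙ g n)     ∎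
    where
    interchange : ∀ {a b u v} → (a ∙ b) ∙ (u ∙ v) ≈ (a ∙ u) ∙ (b ∙ v)
    interchange {a} {b} {u} {v} = begin
      (a ∙ b) ∙ (u ∙ v) ≈⟨ assoc _ _ _ ⟩
      a ∙ (b ∙ (u ∙ v)) ≈⟨ ∙-congˡ (assoc _ _ _) ⟨
      a ∙ ((b ∙ u) ∙ v) ≈⟨ ∙-congˡ (∙-congʳ (comm _ _)) ⟩
      a ∙ ((u ∙ b) ∙ v) ≈⟨ ∙-congˡ (assoc _ _ _) ⟩
      a ∙ (u ∙ (b ∙ v)) ≈⟨ assoc _ _ _ ⟨
      (a ∙ u) ∙ (b ∙ v) ∎

  big-delta : ∀ n i₀ (f : ℕ → Carrier) → i₀ < n → big n (λ i → if i₀ ≡ᵇ i then f i else ε) ≈ f i₀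
  big-delta (suc n) i₀ f i₀<1+n with ℕP.m≤n⇒m<n∨m≡n (ℕP.≤-pred i₀<1+n)
  ... | inj₁ i₀<n rewrite ≡ᵇ-false (ℕP.<⇒≢ i₀<n) =
    trans (identityʳ _) (big-delta n i₀ f i₀<n)
  ... | inj₂ ≡.refl rewrite ≡ᵇ-true (≡.refl {x = i₀}) =
    trans (∙-congʳ (big-ε i₀ (λ i i<i₀ → reflexive (≡.cong (λ b → if b then f i else ε)
                                                            (≡ᵇ-false (ℕP.>⇒≢ i<i₀))))))
          (identityˡ (f i₀))

  big-oneTo : ∀ (f : ℕ → Carrier) n → foldr (λ a r → f a ∙ r) ε (oneTo n) ≈ big n (f ∘ suc)
  big-oneTo f n =
    trans (reflexive (ListP.foldr-map (λ a r → f a ∙ r) suc ε (upTo n))) (fold-applyUpTo n id)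
    where
    fold-applyUpTo : ∀ n (g : ℕ → ℕ) →
                     foldr (λ a r → f (suc a) ∙ r) ε (applyUpTo g n) ≈ big n (f ∘ suc ∘ g)
    fold-applyUpTo zero    g = refl
    fold-applyUpTo (suc n) g =
      trans (∙-congˡ (fold-applyUpTo n (g ∘ suc))) (sym (big-peel n (f ∘ suc ∘ g)))

module RingSums {c ℓ} (R : CommutativeRing c ℓ) where
  open CommutativeRing R hiding (zero)
  open QT R
  open import Relation.Binary.Reasoning.Setoid setoid
  open import Algebra.Properties.Ring ring using (-‿distribˡ-*; -0#≈0#)
  open import Algebra.Properties.AbelianGroup +-abelianGroup using (⁻¹-∙-comm)

  module Add = FiniteFold +-commutativeMonoid
  module Mul = FiniteFold *-commutativeMonoid
  module Solver = Algebra.Solver.Ring.NaturalCoefficients.Default commutativeSemiring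

  pow-+ : ∀ y a b → pow y (a +ℕ b) ≈ pow y a * pow y b
  pow-+ y zero    b = sym (*-identityˡ _)
  pow-+ y (suc a) b = trans (*-congˡ (pow-+ y a b)) (sym (*-assoc _ _ _))

  sumList-cong : ∀ {A : Set} {f g : A → Carrier} (L : List A) → (∀ a → f a ≈ g a) →
                 sumList f L ≈ sumList g L
  sumList-cong []      f≈g = refl
  sumList-cong (a ∷ L) f≈g = +-cong (f≈g a) (sumList-cong L f≈g)

  sumList-congAll : ∀ {A : Set} {P : A → Set} {f g : A → Carrier} {L : List A} → All P L →
                    (∀ a → P a → f a ≈ g a) → sumList f L ≈ sumList g L
  sumList-congAll []         f≈g = refl
  sumList-congAll (pa ∷ pas) f≈g = +-cong (f≈g _ pa) (sumList-congAll pas f≈g)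

  sumList-0 : ∀ {A : Set} {f : A → Carrier} L → (∀ a → f a ≈ 0#) → sumList f L ≈ 0#
  sumList-0 []      f≈0 = refl
  sumList-0 (a ∷ L) f≈0 = trans (+-cong (f≈0 a) (sumList-0 L f≈0)) (+-identityˡ 0#)

  sumList-++ : ∀ {A : Set} (f : A → Carrier) L M → sumList f (L ++ M) ≈ sumList f L + sumList f M
  sumList-++ f []      M = sym (+-identityˡ _)
  sumList-++ f (a ∷ L) M = trans (+-congˡ (sumList-++ f L M)) (sym (+-assoc _ _ _))

  sumList-concatMap : ∀ {A B : Set} (f : B → Carrier) (g : A → List B) L →
                      sumList f (concatMap g L) ≈ sumList (λ a → sumList f (g a)) L
  sumList-concatMap f g []      = refl
  sumList-concatMap f g (a ∷ L) =
    trans (sumList-++ f (g a) (concatMap g L)) (+-congˡ (sumList-concatMap f g L))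

  sumList-map : ∀ {A B : Set} (f : B → Carrier) (g : A → B) L → sumList f (map g L) ≈ sumList (f ∘ g) L
  sumList-map f g []      = refl
  sumList-map f g (a ∷ L) = +-congˡ (sumList-map f g L)

  sumList-*ˡ : ∀ {A : Set} u (f : A → Carrier) L → u * sumList f L ≈ sumList (λ a → u * f a) L
  sumList-*ˡ u f []      = zeroʳ u
  sumList-*ˡ u f (a ∷ L) = trans (distribˡ u _ _) (+-congˡ (sumList-*ˡ u f L))

  sumList-*ʳ : ∀ {A : Set} u (f : A → Carrier) L → sumList f L * u ≈ sumList (λ a → f a * u) L
  sumList-*ʳ u f L =
    trans (*-comm _ u) (trans (sumList-*ˡ u f L) (sumList-cong L (λ a → *-comm u (f a))))

  sumList-neg : ∀ {A : Set} (f : A → Carrier) L → sumList (λ a → - f a) L ≈ - sumList f L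
  sumList-neg f []      = sym -0#≈0#
  sumList-neg f (a ∷ L) = trans (+-congˡ (sumList-neg f L)) (⁻¹-∙-comm _ _)

  sumList-filter : ∀ {A : Set} (f : A → Carrier) (P : A → Bool) L →
    sumList f (foldr (λ a l → if P a then a ∷ l else l) [] L) ≈ sumList (λ a → if P a then f a else 0#) L
  sumList-filter f P []      = refl
  sumList-filter f P (a ∷ L) with P a
  ... | true  = +-congˡ (sumList-filter f P L)
  ... | false = trans (sumList-filter f P L) (sym (+-identityˡ _))

  Add-big-*ʳ : ∀ n (f : ℕ → Carrier) u → Add.big n f * u ≈ Add.big n (λ i → f i * u)
  Add-big-*ʳ zero    f u = zeroˡ u
  Add-big-*ʳ (suc n) f u = trans (distribʳ u _ _) (+-congʳ (Add-big-*ʳ n f u))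

  sumTo≈big : ∀ N f → sumTo N f ≈ Add.big (suc N) f
  sumTo≈big zero    f = sym (+-identityˡ (f 0))
  sumTo≈big (suc N) f = +-congʳ (sumTo≈big N f)

  big-sumList-swap : ∀ {A : Set} n (F : ℕ → A → Carrier) L →
    Add.big n (λ k → sumList (F k) L) ≈ sumList (λ a → Add.big n (λ k → F k a)) L
  big-sumList-swap n F []      = Add.big-ε n (λ _ _ → refl)
  big-sumList-swap n F (a ∷ L) =
    trans (Add.big-∙ n (λ k → F k a) (λ k → sumList (F k) L)) (+-congˡ (big-sumList-swap n F L))

  sum-by-statistic : ∀ {A : Set} N (s : A → ℕ) (g : ℕ → A → Carrier) L → All (λ a → s a ≤ N) L →
    Add.big (suc N) (λ k → sumList (λ a → if s a ≡ᵇ k then g k a else 0#) L) ≈ sumList (λ a → g (s a) a) L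
  sum-by-statistic N s g L s≤N =
    trans (big-sumList-swap (suc N) (λ k a → if s a ≡ᵇ k then g k a else 0#) L)
          (sumList-congAll s≤N (λ a sa≤N → Add.big-delta (suc N) (s a) (λ k → g k a) (s≤s sa≤N)))

module QtIntegers {c ℓ} (R : CommutativeRing c ℓ) (q t : CommutativeRing.Carrier R) where
  open CommutativeRing R hiding (zero)
  open QT R
  open RingSums R
  open import Relation.Binary.Reasoning.Setoid setoid

  evenPowers : ℕ → Carrier
  evenPowers m = Add.big m (λ i → if isEven i then pow q i else 0#)

  evenPowers-pair : ∀ m → (if isEven m then pow q m else 0#) + (if isEven (suc m) then pow q (suc m) else 0#)
                          ≈ pow q (2 *ℕ (suc m / 2))
  evenPowers-pair m with parity m
  ... | even e o d rewrite e | o | d = +-identityʳ _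
  ... | odd  e o d rewrite e | o | d = +-identityˡ _

  evenPowers≈geo : ∀ m → evenPowers m ≈ geo q t (suc m / 2)
  evenPowers≈geo zero          = refl
  evenPowers≈geo (suc zero)    = refl
  evenPowers≈geo (suc (suc m)) = begin
    (evenPowers m + (if isEven m then pow q m else 0#)) + (if isEven (suc m) then pow q (suc m) else 0#)
      ≈⟨ +-assoc _ _ _ ⟩
    evenPowers m + ((if isEven m then pow q m else 0#) + (if isEven (suc m) then pow q (suc m) else 0#))
      ≈⟨ +-cong (evenPowers≈geo m) (evenPowers-pair m) ⟩
    geo q t (suc (suc m / 2))
      ≡⟨ ≡.cong (geo q t) (half-suc-suc (suc m)) ⟨
    geo q t (suc (suc (suc m)) / 2) ∎

  tExp : ℕ → ℕ → ℕ
  tExp m i = if suc i <ᵇ m then 1 else 0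

  qtTerm : ℕ → ℕ → Carrier
  qtTerm m i = if isEven i then pow q i * pow t (tExp m i) else 0#

  qtSum≈qtInt : ∀ m → Add.big m (qtTerm m) ≈ qtInt q t m
  qtSum≈qtInt zero    = refl
  qtSum≈qtInt (suc m) = begin
    Add.big m (qtTerm (suc m)) + qtTerm (suc m) m
      ≈⟨ +-cong (Add.big-cong m lower-term) (reflexive top-term) ⟩
    Add.big m (λ i → (if isEven i then pow q i else 0#) * t) + (if isEven m then pow q m * 1# else 0#)
      ≈⟨ +-congʳ (trans (sym (Add-big-*ʳ m _ t)) (*-congʳ (evenPowers≈geo m))) ⟩
    geo q t (suc m / 2) * t + (if isEven m then pow q m * 1# else 0#)
      ≈⟨ by-parity (parity m) ⟩
    qtInt q t (suc m) ∎
    where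
    lower-term : ∀ i → i < m → qtTerm (suc m) i ≈ (if isEven i then pow q i else 0#) * t
    lower-term i i<m rewrite <ᵇ-true i<m with isEven i
    ... | true  = *-congˡ (*-identityʳ t)
    ... | false = sym (zeroˡ t)
    top-term : qtTerm (suc m) m ≡ (if isEven m then pow q m * 1# else 0#)
    top-term rewrite <ᵇ-false {m} {m} ℕP.≤-refl = ≡.refl
    by-parity : Parity m → geo q t (suc m / 2) * t + (if isEven m then pow q m * 1# else 0#) ≈ qtInt q t (suc m)
    by-parity (even e o _) rewrite e | o = trans (+-congˡ (*-identityʳ _)) (+-comm _ _)
    by-parity (odd  e o _) rewrite e | o = +-identityʳ _

-- Part (1): the falling factorial as a generating function of rook placements.

module RookExpansion {c ℓ} (R : CommutativeRing c ℓ) (q t x : CommutativeRing.Carrier R) where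
  open CommutativeRing R hiding (zero)
  open QT R
  open RingSums R
  open QtIntegers R q t
  open import Relation.Binary.Reasoning.Setoid setoid
  open import Algebra.Properties.Ring ring using (-‿distribˡ-*)

  rookWeight : ℕ → ℕ → List (ℕ × ℕ) → Carrier
  rookWeight n L T = pow (- 1#) (length T) * (pow q (below n T) * pow t (nrow T)) * pow x (L ∸ length T)

  rookSum : ℕ → List ℕ → Carrier
  rookSum n js = sumList (rookWeight n (length js)) (placeCols n js)

  -- The weight q^(squares below) t^[not row 1] of a rook on square (i , j),
  -- and the total weight of the shaded squares of column j.
  squareWeight : ℕ → ℕ → ℕ → Carrier
  squareWeight n j i = pow q (n ∸ i ∸ j) * pow t (if i ≡ᵇ 1 then 0 else 1)

  columnWeight : ℕ → ℕ → Carrier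
  columnWeight n j = sumList (squareWeight n j) (shadedRows n j)

  placeCols-size : ∀ n js → All (λ T → length T ≤ length js) (placeCols n js)
  placeCols-size n []       = z≤n ∷ []
  placeCols-size n (j ∷ js) =
    AllP.concat⁺ (AllP.map⁺ (All.map extend (placeCols-size n js)))
    where
    extend : ∀ {T} → length T ≤ length js →
             All (λ T′ → length T′ ≤ suc (length js)) (T ∷ map (λ i → (i , j) ∷ T) (shadedRows n j))
    extend |T|≤ = ℕP.m≤n⇒m≤1+n |T|≤ ∷ AllP.map⁺ (All.universal (λ _ → s≤s |T|≤) _)

  rookWeight-skip : ∀ n L T → length T ≤ L → rookWeight n (suc L) T ≈ rookWeight n L T * x
  rookWeight-skip n L T |T|≤L rewrite ℕP.+-∸-assoc 1 |T|≤L =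
    Solver.solve 3 (λ a b c → a :* (b :* c) := (a :* c) :* b) refl _ _ _
    where open Solver using (_:*_; _:=_)

  rookWeight-place : ∀ n L T i j → rookWeight n (suc L) ((i , j) ∷ T) ≈ rookWeight n L T * (- squareWeight n j i)
  rookWeight-place n L T i j = begin
    pow (- 1#) (suc (length T)) * (pow q (n ∸ i ∸ j +ℕ below n T) * pow t (e +ℕ nrow T)) * pow x (L ∸ length T)
      ≈⟨ *-congʳ (*-congˡ (*-cong (pow-+ q (n ∸ i ∸ j) (below n T)) (pow-+ t e (nrow T)))) ⟩
    (- 1# * pow (- 1#) (length T)) * ((pow q (n ∸ i ∸ j) * pow q (below n T)) * (pow t e * pow t (nrow T)))
      * pow x (L ∸ length T)
      ≈⟨ Solver.solve 7 (λ m s a b c d X → ((m :* s) :* ((a :* b) :* (c :* d))) :* X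
                                        := ((s :* (b :* d)) :* X) :* (m :* (a :* c))) refl _ _ _ _ _ _ _ ⟩
    rookWeight n L T * (- 1# * squareWeight n j i)
      ≈⟨ *-congˡ (trans (sym (-‿distribˡ-* _ _)) (-‿cong (*-identityˡ _))) ⟩
    rookWeight n L T * (- squareWeight n j i) ∎
    where
    open Solver using (_:*_; _:=_)
    e : ℕ
    e = if i ≡ᵇ 1 then 0 else 1

  rookSum-cons : ∀ n j js → rookSum n (j ∷ js) ≈ rookSum n js * (x - columnWeight n j)
  rookSum-cons n j js = begin
    sumList (rookWeight n (suc L)) (concatMap extensions (placeCols n js))
      ≈⟨ sumList-concatMap (rookWeight n (suc L)) extensions (placeCols n js) ⟩
    sumList (λ T → sumList (rookWeight n (suc L)) (extensions T)) (placeCols n js)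
      ≈⟨ sumList-congAll (placeCols-size n js) extensions-sum ⟩
    sumList (λ T → rookWeight n L T * (x - columnWeight n j)) (placeCols n js)
      ≈⟨ sumList-*ʳ (x - columnWeight n j) (rookWeight n L) (placeCols n js) ⟨
    rookSum n js * (x - columnWeight n j) ∎
    where
    L : ℕ
    L = length js
    extensions : List (ℕ × ℕ) → List (List (ℕ × ℕ))
    extensions T = T ∷ map (λ i → (i , j) ∷ T) (shadedRows n j)
    extensions-sum : ∀ T → length T ≤ L →
                     sumList (rookWeight n (suc L)) (extensions T) ≈ rookWeight n L T * (x - columnWeight n j)
    extensions-sum T |T|≤L = begin
      rookWeight n (suc L) T + sumList (rookWeight n (suc L)) (map (λ i → (i , j) ∷ T) (shadedRows n j))
        ≈⟨ +-cong (rookWeight-skip n L T |T|≤L)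
                  (trans (sumList-map (rookWeight n (suc L)) (λ i → (i , j) ∷ T) (shadedRows n j))
                         (sumList-cong (shadedRows n j) (λ i → rookWeight-place n L T i j))) ⟩
      rookWeight n L T * x + sumList (λ i → rookWeight n L T * (- squareWeight n j i)) (shadedRows n j)
        ≈⟨ +-congˡ (sym (sumList-*ˡ (rookWeight n L T) (λ i → - squareWeight n j i) (shadedRows n j))) ⟩
      rookWeight n L T * x + rookWeight n L T * sumList (λ i → - squareWeight n j i) (shadedRows n j)
        ≈⟨ sym (distribˡ _ _ _) ⟩
      rookWeight n L T * (x + sumList (λ i → - squareWeight n j i) (shadedRows n j))
        ≈⟨ *-congˡ (+-congˡ (sumList-neg (squareWeight n j) (shadedRows n j))) ⟩
      rookWeight n L T * (x - columnWeight n j) ∎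

  -- Reading a column from the bottom: row N - i of an N-square column.
  mirror : ∀ N i → i < N → N ∸ suc (N ∸ suc i) ≡ i
  mirror N i i<N = ≡.trans (≡.sym (ℕP.pred[m∸n]≡m∸[1+n] N (N ∸ suc i))) (≡.cong pred (ℕP.m∸[m∸n]≡n i<N))

  -- Counted from the bottom, square i of an N-square column lies in row 1 iff
  -- it is the top square i = N - 1, matching the t-exponent of [N]_{q,t}.
  mirror-row1 : ∀ N i → i < N → (if suc (N ∸ suc i) ≡ᵇ 1 then 0 else 1) ≡ tExp N i
  mirror-row1 (suc zero)    zero    _         = ≡.refl
  mirror-row1 (suc (suc N)) zero    _         = ≡.refl
  mirror-row1 (suc N)       (suc i) (s≤s i<N) = mirror-row1 N i i<N

  ∸-swap : ∀ n a j → n ∸ a ∸ j ≡ n ∸ j ∸ a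
  ∸-swap n a j = ≡.trans (ℕP.∸-+-assoc n a j)
                         (≡.trans (≡.cong (n ∸_) (ℕP.+-comm a j)) (≡.sym (ℕP.∸-+-assoc n j a)))

  -- The shaded squares of column j carry the q,t-integer [n - j]_{q,t}: the
  -- square at height i above the bottom has weight q^i t^[not row 1].
  columnWeight≈qtInt : ∀ n j → columnWeight n j ≈ qtInt q t (n ∸ j)
  columnWeight≈qtInt n j = begin
    columnWeight n j
      ≈⟨ sumList-filter (squareWeight n j) (λ i → isEven (n ∸ i ∸ j)) (oneTo N) ⟩
    sumList shaded (oneTo N)                   ≈⟨ Add.big-oneTo shaded N ⟩
    Add.big N (shaded ∘ suc)                   ≈⟨ Add.big-reverse N (shaded ∘ suc) ⟩
    Add.big N (λ i → shaded (suc (N ∸ suc i))) ≈⟨ Add.big-cong N from-bottom ⟩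
    Add.big N (qtTerm N)                       ≈⟨ qtSum≈qtInt N ⟩
    qtInt q t N ∎
    where
    N : ℕ
    N = n ∸ j
    shaded : ℕ → Carrier
    shaded i = if isEven (n ∸ i ∸ j) then squareWeight n j i else 0#
    from-bottom : ∀ i → i < N → shaded (suc (N ∸ suc i)) ≈ qtTerm N i
    from-bottom i i<N rewrite ∸-swap n (suc (N ∸ suc i)) j | mirror N i i<N | mirror-row1 N i i<N = refl

  rookSum-product : ∀ n js → rookSum n js ≈ foldr (λ j r → (x - qtInt q t (n ∸ j)) * r) 1# js
  rookSum-product n []       = trans (+-identityʳ _) (trans (*-identityʳ _) (trans (*-identityˡ _) (*-identityˡ _)))
  rookSum-product n (j ∷ js) = begin
    rookSum n (j ∷ js)                                       ≈⟨ rookSum-cons n j js ⟩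
    rookSum n js * (x - columnWeight n j)                    ≈⟨ *-comm _ _ ⟩
    (x - columnWeight n j) * rookSum n js                    ≈⟨ *-cong (+-congˡ (-‿cong (columnWeight≈qtInt n j)))
                                                                       (rookSum-product n js) ⟩
    (x - qtInt q t (n ∸ j)) * foldr (λ j r → (x - qtInt q t (n ∸ j)) * r) 1# js ∎

  falling-as-product : ∀ n → falling q t x n ≈ Mul.big n (λ i → x - qtInt q t i)
  falling-as-product zero    = refl
  falling-as-product (suc n) = *-congʳ (falling-as-product n)

  length-oneTo : ∀ n → length (oneTo n) ≡ n
  length-oneTo n = ≡.trans (ListP.length-map suc (upTo n)) (ListP.length-upTo n)

  -- On the full staircase the column factors are x - [n-1], …, x - [0].
  rookSum-staircase : ∀ n → sumList (rookWeight n n) (placements n) ≈ falling q t x n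
  rookSum-staircase n = ≡.subst (λ L → sumList (rookWeight n L) (placements n) ≈ falling q t x n)
                                (length-oneTo n) columns-product
    where
    columns-product : rookSum n (oneTo n) ≈ falling q t x n
    columns-product = begin
      rookSum n (oneTo n)
        ≈⟨ rookSum-product n (oneTo n) ⟩
      foldr (λ j r → (x - qtInt q t (n ∸ j)) * r) 1# (oneTo n)
        ≈⟨ Mul.big-oneTo (λ j → x - qtInt q t (n ∸ j)) n ⟩
      Mul.big n (λ i → x - qtInt q t (n ∸ suc i))
        ≈⟨ Mul.big-reverse n _ ⟩
      Mul.big n (λ i → x - qtInt q t (n ∸ suc (n ∸ suc i)))
        ≈⟨ Mul.big-cong n (λ i i<n → reflexive (≡.cong (λ k → x - qtInt q t k) (mirror n i i<n))) ⟩
      Mul.big n (λ i → x - qtInt q t i)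
        ≈⟨ falling-as-product n ⟨
      falling q t x n ∎

  placements-size : ∀ n → All (λ T → length T ≤ n) (placements n)
  placements-size n = ≡.subst (λ L → All (λ T → length T ≤ L) (placements n)) (length-oneTo n)
                              (placeCols-size n (oneTo n))

  rook-coefficient : ∀ n k → k ≤ suc n →
    sqt q t (suc n) k * pow x k
      ≈ sumList (λ T → if suc n ∸ length T ≡ᵇ k then rookWeight (suc n) (suc n) T else 0#) (placements (suc n))
  rook-coefficient n k k≤N rewrite ≤ᵇ-true k≤N = begin
    (sign * sumList counted (placements N)) * pow x k
      ≈⟨ *-congʳ (sumList-*ˡ sign counted (placements N)) ⟩
    sumList (λ T → sign * counted T) (placements N) * pow x k
      ≈⟨ sumList-*ʳ (pow x k) (λ T → sign * counted T) (placements N) ⟩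
    sumList (λ T → (sign * counted T) * pow x k) (placements N)
      ≈⟨ sumList-congAll (placements-size N) term ⟩
    sumList (λ T → if N ∸ length T ≡ᵇ k then rookWeight N N T else 0#) (placements N) ∎
    where
    N : ℕ
    N = suc n
    sign : Carrier
    sign = pow (- 1#) (N ∸ k)
    counted : List (ℕ × ℕ) → Carrier
    counted T = if length T ≡ᵇ N ∸ k then pow q (below N T) * pow t (nrow T) else 0#
    complement : ∀ {a b} → a ≤ N → N ∸ a ≡ b → a ≡ N ∸ b
    complement a≤N N∸a≡b = ≡.trans (≡.sym (ℕP.m∸[m∸n]≡n a≤N)) (≡.cong (N ∸_) N∸a≡b)
    term : ∀ T → length T ≤ N →
           (sign * counted T) * pow x k ≈ (if N ∸ length T ≡ᵇ k then rookWeight N N T else 0#)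
    term T |T|≤N with length T ≟ N ∸ k
    ... | yes |T|≡ rewrite |T|≡ | ≡ᵇ-true (≡.refl {x = N ∸ k}) | ℕP.m∸[m∸n]≡n k≤N | ≡ᵇ-true (≡.refl {x = k}) =
      refl
    ... | no  |T|≢ rewrite ≡ᵇ-false |T|≢ | ≡ᵇ-false {N ∸ length T} {k} (|T|≢ ∘ complement |T|≤N) =
      trans (*-congʳ (zeroʳ _)) (zeroˡ _)

  rook-expansion : ∀ n → falling q t x n ≈ sumTo n (λ k → sqt q t n k * pow x k)
  rook-expansion zero    = sym (*-identityʳ 1#)
  rook-expansion (suc n) = sym (begin
    sumTo (suc n) (λ k → sqt q t (suc n) k * pow x k)
      ≈⟨ sumTo≈big (suc n) _ ⟩
    Add.big (suc (suc n)) (λ k → sqt q t (suc n) k * pow x k)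
      ≈⟨ Add.big-cong (suc (suc n)) (λ k k<2+n → rook-coefficient n k (ℕP.≤-pred k<2+n)) ⟩
    Add.big (suc (suc n)) (λ k → sumList (λ T → if suc n ∸ length T ≡ᵇ k then rookWeight (suc n) (suc n) T else 0#)
                                         (placements (suc n)))
      ≈⟨ sum-by-statistic (suc n) (λ T → suc n ∸ length T) (λ _ → rookWeight (suc n) (suc n)) (placements (suc n))
                          (All.universal (λ T → ℕP.m∸n≤m (suc n) (length T)) _) ⟩
    sumList (rookWeight (suc n) (suc n)) (placements (suc n))
      ≈⟨ rookSum-staircase (suc n) ⟩
    falling q t x (suc n) ∎)

count-++ : ∀ e p s → count e (p ++ s) ≡ count e p +ℕ count e s
count-++ e []      s = ≡.refl
count-++ e (b ∷ p) s = ≡.trans (≡.cong ((if b ≡ᵇ e then 1 else 0) +ℕ_) (count-++ e p s))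
                               (≡.sym (ℕP.+-assoc (if b ≡ᵇ e then 1 else 0) _ _))

maxL-++ : ∀ p s → maxL (p ++ s) ≡ maxL p ⊔ maxL s
maxL-++ []      s = ≡.refl
maxL-++ (b ∷ p) s = ≡.trans (≡.cong (b ⊔_) (maxL-++ p s)) (≡.sym (ℕP.⊔-assoc b _ _))

maxL-snoc : ∀ p a → maxL (p ++ a ∷ []) ≡ maxL p ⊔ a
maxL-snoc p a = ≡.trans (maxL-++ p (a ∷ [])) (≡.cong (maxL p ⊔_) (ℕP.⊔-identityʳ a))

count-above-max : ∀ e p → maxL p < e → count e p ≡ 0
count-above-max e []      _ = ≡.refl
count-above-max e (b ∷ p) p<e
  rewrite ≡ᵇ-false {b} {e} (ℕP.<⇒≢ (ℕP.≤-<-trans (ℕP.m≤m⊔n b (maxL p)) p<e))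
  = count-above-max e p (ℕP.≤-<-trans (ℕP.m≤n⊔m b (maxL p)) p<e)

-- Every letter 1, …, max p occurs in p: the invariant of RG-word prefixes.
Covers : List ℕ → Set
Covers p = ∀ e → 1 ≤ e → e ≤ maxL p → 1 ≤ count e p

new-maximum : ∀ {m i e} → i ≤ m → ¬ e ≤ m → e ≤ m ⊔ suc i → suc i ≡ e
new-maximum {m} {i} {e} i≤m e≰m e≤⊔ = ℕP.≤-antisym (ℕP.≤-trans (s≤s i≤m) (ℕP.≰⇒> e≰m)) e≤1+i
  where
  e≤1+i : e ≤ suc i
  e≤1+i = [ (λ ⊔≡m → ⊥-elim (e≰m (≡.subst (_ ≤_) ⊔≡m e≤⊔))) , (λ ⊔≡1+i → ≡.subst (_ ≤_) ⊔≡1+i e≤⊔) ]′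
          (ℕP.⊔-sel m (suc i))

covers-snoc : ∀ p i → Covers p → i ≤ maxL p → Covers (p ++ suc i ∷ [])
covers-snoc p i covers i≤m e 1≤e e≤max rewrite count-++ e p (suc i ∷ []) with e ≤? maxL p
... | yes e≤m = ℕP.≤-trans (covers e 1≤e e≤m) (ℕP.m≤m+n _ _)
... | no  e≰m rewrite ≡ᵇ-true (new-maximum i≤m e≰m (≡.subst (e ≤_) (maxL-snoc p (suc i)) e≤max)) =
  ℕP.m≤n+m 1 _

second-copy : ∀ {c} → 1 ≤ c → c +ℕ 1 ≢ 1
second-copy {c} 1≤c c+1≡1 = ℕP.<⇒≢ 1≤c (≡.sym (ℕP.suc-injective (≡.trans (ℕP.+-comm 1 c) c+1≡1)))

-- A word is admissible when each even letter up to its maximum occurs once;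
-- `inA k w` is "max w = k and w admissible".
evenOnceTest : List ℕ → ℕ → Bool
evenOnceTest w e = not (isEven e) ∨ (count e w ≡ᵇ 1)

evenOnce : List ℕ → Bool
evenOnce w = foldr (λ e b → evenOnceTest w e ∧ b) true (oneTo (maxL w))

module Conj = FiniteFold BoolP.∧-commutativeMonoid

evenOnce-as-big : ∀ w → evenOnce w ≡ Conj.big (maxL w) (evenOnceTest w ∘ suc)
evenOnce-as-big w = Conj.big-oneTo (evenOnceTest w) (maxL w)

-- Appending an old letter a ≤ max p keeps admissibility iff a is odd (a
-- already occurs in p, so a second copy is fine only for odd a).
evenOnce-snoc-old : ∀ p i → Covers p → suc i ≤ maxL p →
                    evenOnce (p ++ suc i ∷ []) ≡ evenOnce p ∧ not (isEven (suc i))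
evenOnce-snoc-old p i covers 1+i≤m = begin
  evenOnce (p ++ suc i ∷ [])
    ≡⟨ evenOnce-as-big (p ++ suc i ∷ []) ⟩
  Conj.big (maxL (p ++ suc i ∷ [])) (evenOnceTest (p ++ suc i ∷ []) ∘ suc)
    ≡⟨ ≡.cong (λ m → Conj.big m (evenOnceTest (p ++ suc i ∷ []) ∘ suc))
              (≡.trans (maxL-snoc p (suc i)) (ℕP.m≥n⇒m⊔n≡m 1+i≤m)) ⟩
  Conj.big (maxL p) (evenOnceTest (p ++ suc i ∷ []) ∘ suc)
    ≡⟨ Conj.big-cong (maxL p) (λ e _ → updated-test e) ⟩
  Conj.big (maxL p) (λ e → evenOnceTest p (suc e) ∧ (if i ≡ᵇ e then isOdd else true))
    ≡⟨ Conj.big-∙ (maxL p) (evenOnceTest p ∘ suc) (λ e → if i ≡ᵇ e then isOdd else true) ⟩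
  Conj.big (maxL p) (evenOnceTest p ∘ suc) ∧ Conj.big (maxL p) (λ e → if i ≡ᵇ e then isOdd else true)
    ≡⟨ ≡.cong₂ _∧_ (≡.sym (evenOnce-as-big p)) (Conj.big-delta (maxL p) i (λ _ → isOdd) 1+i≤m) ⟩
  evenOnce p ∧ isOdd ∎
  where
  open ≡.≡-Reasoning
  isOdd : Bool
  isOdd = not (isEven (suc i))
  updated-test : ∀ e → evenOnceTest (p ++ suc i ∷ []) (suc e)
                       ≡ evenOnceTest p (suc e) ∧ (if i ≡ᵇ e then isOdd else true)
  updated-test e rewrite count-++ (suc e) p (suc i ∷ []) with i ≟ e
  ... | no i≢e rewrite ≡ᵇ-false i≢e | ℕP.+-identityʳ (count (suc e) p) = ≡.sym (BoolP.∧-identityʳ _)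
  ... | yes ≡.refl rewrite ≡ᵇ-true (≡.refl {x = i})
                         | ≡ᵇ-false (second-copy (covers (suc i) (s≤s z≤n) 1+i≤m)) with isOdd
  ...   | true  = ≡.refl
  ...   | false = ≡.sym (BoolP.∧-zeroʳ _)

-- Appending the new letter max p + 1 (which occurs once) keeps admissibility unchanged.
evenOnce-snoc-new : ∀ p → evenOnce (p ++ suc (maxL p) ∷ []) ≡ evenOnce p
evenOnce-snoc-new p = begin
  evenOnce (p ++ a ∷ [])
    ≡⟨ evenOnce-as-big (p ++ a ∷ []) ⟩
  Conj.big (maxL (p ++ a ∷ [])) (evenOnceTest (p ++ a ∷ []) ∘ suc)
    ≡⟨ ≡.cong (λ m → Conj.big m (evenOnceTest (p ++ a ∷ []) ∘ suc))
              (≡.trans (maxL-snoc p a) (ℕP.m≤n⇒m⊔n≡n (ℕP.n≤1+n (maxL p)))) ⟩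
  Conj.big (maxL p) (evenOnceTest (p ++ a ∷ []) ∘ suc) ∧ evenOnceTest (p ++ a ∷ []) a
    ≡⟨ ≡.cong₂ _∧_ (Conj.big-cong (maxL p) old-test) new-test ⟩
  Conj.big (maxL p) (evenOnceTest p ∘ suc) ∧ true
    ≡⟨ BoolP.∧-identityʳ _ ⟩
  Conj.big (maxL p) (evenOnceTest p ∘ suc)
    ≡⟨ evenOnce-as-big p ⟨
  evenOnce p ∎
  where
  open ≡.≡-Reasoning
  a : ℕ
  a = suc (maxL p)
  old-test : ∀ e → e < maxL p → evenOnceTest (p ++ a ∷ []) (suc e) ≡ evenOnceTest p (suc e)
  old-test e e<m rewrite count-++ (suc e) p (a ∷ []) | ≡ᵇ-false (ℕP.>⇒≢ e<m)
                       | ℕP.+-identityʳ (count (suc e) p) = ≡.refl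
  new-test : evenOnceTest (p ++ a ∷ []) a ≡ true
  new-test rewrite count-++ a p (a ∷ []) | count-above-max a p ℕP.≤-refl
                 | ≡ᵇ-true (≡.refl {x = maxL p}) = BoolP.∨-zeroʳ _

rgGo-max : ∀ r m → All (λ s → maxL s ≤ r +ℕ m) (rgGo r m)
rgGo-max zero    m = z≤n ∷ []
rgGo-max (suc r) m =
  AllP.concat⁺ (AllP.map⁺ (AllP.map⁺ (AllP.applyUpTo⁺₁ id (suc m) (λ {i} i≤m →
    AllP.map⁺ (All.map (λ {s} → bound i s i≤m) (rgGo-max r (m ⊔ suc i)))))))
  where
  bound : ∀ i s → i < suc m → maxL s ≤ r +ℕ (m ⊔ suc i) → suc i ⊔ maxL s ≤ suc r +ℕ m
  bound i s (s≤s i≤m) s≤ = ℕP.⊔-lub (s≤s (ℕP.≤-trans i≤m (ℕP.m≤n+m m r)))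
    (ℕP.≤-trans s≤ (ℕP.≤-trans (ℕP.+-monoʳ-≤ r (ℕP.⊔-lub (ℕP.n≤1+n m) (s≤s i≤m)))
                               (ℕP.≤-reflexive (ℕP.+-suc r m))))

rgWords-max : ∀ n → All (λ w → 1 ≤ maxL w × maxL w ≤ suc n) (rgWords (suc n))
rgWords-max n = AllP.map⁺ (All.map (λ {s} s≤ → ℕP.m≤m⊔n 1 (maxL s) ,
                                               ℕP.⊔-lub (s≤s z≤n) (ℕP.≤-trans s≤ (ℕP.≤-reflexive (ℕP.+-comm n 1))))
                                   (rgGo-max n 1))

-- Part (2): powers of x in the basis of falling factorials, via RG-words.

module RGExpansion {c ℓ} (R : CommutativeRing c ℓ) (q t x : CommutativeRing.Carrier R) where
  open CommutativeRing R hiding (zero)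
  open QT R
  open RingSums R
  open QtIntegers R q t
  open import Relation.Binary.Reasoning.Setoid setoid
  open import Algebra.Properties.Ring ring using (-0#≈0#)

  wordWeight : List ℕ → Carrier
  wordWeight w = if evenOnce w then pow q (statA w) * pow t (statB w) else 0#

  prefixValue : List ℕ → Carrier
  prefixValue p = if evenOnce p then falling q t x (maxL p) else 0#

  -- The weight of the word p ++ s, where s continues p from the maximum m,
  -- with the statistics A and B counted on s only.
  continuationWeight : ℕ → List ℕ → List ℕ → Carrier
  continuationWeight m p s =
    (if evenOnce (p ++ s) then pow q (statAGo m s) * pow t (statBGo m s) else 0#) * falling q t x (maxL (p ++ s))

  continuationSum : ℕ → ℕ → List ℕ → Carrier
  continuationSum r m p = sumList (continuationWeight m p) (rgGo r m)

  letterWeight : ℕ → ℕ → Carrier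
  letterWeight m a = pow q (if a ≤ᵇ m then a ∸ 1 else 0) * pow t (if a <ᵇ m then 1 else 0)

  continuationWeight-cons : ∀ m p a s →
    continuationWeight m p (a ∷ s) ≈ letterWeight m a * continuationWeight (m ⊔ a) (p ++ a ∷ []) s
  continuationWeight-cons m p a s rewrite ≡.sym (ListP.++-assoc p (a ∷ []) s) with evenOnce ((p ++ a ∷ []) ++ s)
  ... | true = trans (*-congʳ (*-cong (pow-+ q eA (statAGo (m ⊔ a) s)) (pow-+ t eB (statBGo (m ⊔ a) s))))
                     (Solver.solve 5 (λ a b c d F → ((a :* b) :* (c :* d)) :* F := (a :* c) :* ((b :* d) :* F))
                                   refl _ _ _ _ _)
    where
    open Solver using (_:*_; _:=_)
    eA eB : ℕ
    eA = if a ≤ᵇ m then a ∸ 1 else 0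
    eB = if a <ᵇ m then 1 else 0
  ... | false = trans (zeroˡ _) (sym (trans (*-congˡ (zeroˡ _)) (zeroʳ _)))

  continuationSum-suc : ∀ r m p → continuationSum (suc r) m p
    ≈ Add.big (suc m) (λ i → letterWeight m (suc i) * continuationSum r (m ⊔ suc i) (p ++ suc i ∷ []))
  continuationSum-suc r m p = begin
    sumList (continuationWeight m p) (concatMap branch (oneTo (suc m)))
      ≈⟨ sumList-concatMap (continuationWeight m p) branch (oneTo (suc m)) ⟩
    sumList (λ a → sumList (continuationWeight m p) (branch a)) (oneTo (suc m))
      ≈⟨ sumList-cong (oneTo (suc m)) first-letter ⟩
    sumList (λ a → letterWeight m a * continuationSum r (m ⊔ a) (p ++ a ∷ [])) (oneTo (suc m))
      ≈⟨ Add.big-oneTo (λ a → letterWeight m a * continuationSum r (m ⊔ a) (p ++ a ∷ [])) (suc m) ⟩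
    Add.big (suc m) (λ i → letterWeight m (suc i) * continuationSum r (m ⊔ suc i) (p ++ suc i ∷ [])) ∎
    where
    branch : ℕ → List (List ℕ)
    branch a = map (a ∷_) (rgGo r (m ⊔ a))
    first-letter : ∀ a → sumList (continuationWeight m p) (branch a)
                         ≈ letterWeight m a * continuationSum r (m ⊔ a) (p ++ a ∷ [])
    first-letter a = begin
      sumList (continuationWeight m p) (branch a)
        ≈⟨ sumList-map (continuationWeight m p) (a ∷_) (rgGo r (m ⊔ a)) ⟩
      sumList (λ s → continuationWeight m p (a ∷ s)) (rgGo r (m ⊔ a))
        ≈⟨ sumList-cong (rgGo r (m ⊔ a)) (continuationWeight-cons m p a) ⟩
      sumList (λ s → letterWeight m a * continuationWeight (m ⊔ a) (p ++ a ∷ []) s) (rgGo r (m ⊔ a))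
        ≈⟨ sumList-*ˡ (letterWeight m a) (continuationWeight (m ⊔ a) (p ++ a ∷ [])) (rgGo r (m ⊔ a)) ⟨
      letterWeight m a * continuationSum r (m ⊔ a) (p ++ a ∷ []) ∎

  old-letter : ∀ p i → Covers p → suc i ≤ maxL p →
    letterWeight (maxL p) (suc i) * prefixValue (p ++ suc i ∷ []) ≈ qtTerm (maxL p) i * prefixValue p
  old-letter p i covers 1+i≤m
    rewrite evenOnce-snoc-old p i covers 1+i≤m | maxL-snoc p (suc i) | ℕP.m≥n⇒m⊔n≡m 1+i≤m
          | isEven-suc i | ≤ᵇ-true 1+i≤m
    with evenOnce p | isEven i
  ... | true  | true  = refl
  ... | true  | false = trans (zeroʳ _) (sym (zeroˡ _))
  ... | false | true  = trans (zeroʳ _) (sym (zeroʳ _))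
  ... | false | false = trans (zeroʳ _) (sym (zeroʳ _))

  new-letter : ∀ p → letterWeight (maxL p) (suc (maxL p)) * prefixValue (p ++ suc (maxL p) ∷ [])
                     ≈ prefixValue p * (x - qtInt q t (maxL p))
  new-letter p
    rewrite evenOnce-snoc-new p | maxL-snoc p (suc (maxL p)) | ℕP.m≤n⇒m⊔n≡n (ℕP.n≤1+n (maxL p))
          | ≤ᵇ-false {suc (maxL p)} {maxL p} ℕP.≤-refl | <ᵇ-false {suc (maxL p)} {maxL p} (ℕP.n≤1+n (maxL p))
    with evenOnce p
  ... | true  = trans (*-congʳ (*-identityˡ 1#)) (*-identityˡ _)
  ... | false = trans (zeroʳ _) (sym (zeroˡ _))

  cancel : ∀ F c X → c * (F * X) + (F * (x - c)) * X ≈ F * (x * X)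
  cancel F c X = begin
    c * (F * X) + (F * (x - c)) * X
      ≈⟨ Solver.solve 5 (λ F c d x X → c :* (F :* X) :+ (F :* (x :+ d)) :* X
                                     := F :* (x :* X) :+ (F :* X) :* (c :+ d)) refl F c (- c) x X ⟩
    F * (x * X) + (F * X) * (c - c) ≈⟨ +-congˡ (trans (*-congˡ (-‿inverseʳ c)) (zeroʳ _)) ⟩
    F * (x * X) + 0#                ≈⟨ +-identityʳ _ ⟩
    F * (x * X) ∎
    where open Solver using (_:*_; _:+_; _:=_)

  continuationSum-closed : ∀ r p → Covers p → continuationSum r (maxL p) p ≈ prefixValue p * pow x r
  continuationSum-closed zero p _ rewrite ListP.++-identityʳ p with evenOnce p
  ... | true  = trans (+-identityʳ _) (trans (*-congʳ (*-identityˡ 1#)) (trans (*-identityˡ _) (sym (*-identityʳ _))))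
  ... | false = trans (+-identityʳ _) (trans (zeroˡ _) (sym (zeroˡ _)))
  continuationSum-closed (suc r) p covers = begin
    continuationSum (suc r) m p
      ≈⟨ continuationSum-suc r m p ⟩
    Add.big m next + next m
      ≈⟨ +-cong (Add.big-cong m old) new ⟩
    Add.big m (λ i → qtTerm m i * (prefixValue p * X)) + (prefixValue p * (x - qtInt q t m)) * X
      ≈⟨ +-congʳ (trans (sym (Add-big-*ʳ m (qtTerm m) _)) (*-congʳ (qtSum≈qtInt m))) ⟩
    qtInt q t m * (prefixValue p * X) + (prefixValue p * (x - qtInt q t m)) * X
      ≈⟨ cancel (prefixValue p) (qtInt q t m) X ⟩
    prefixValue p * (x * X) ∎
    where
    m : ℕ
    m = maxL p
    X : Carrier
    X = pow x r
    next : ℕ → Carrier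
    next i = letterWeight m (suc i) * continuationSum r (m ⊔ suc i) (p ++ suc i ∷ [])
    extended : ∀ i → i ≤ m → continuationSum r (m ⊔ suc i) (p ++ suc i ∷ []) ≈ prefixValue (p ++ suc i ∷ []) * X
    extended i i≤m rewrite ≡.sym (maxL-snoc p (suc i)) =
      continuationSum-closed r (p ++ suc i ∷ []) (covers-snoc p i covers i≤m)
    old : ∀ i → i < m → next i ≈ qtTerm m i * (prefixValue p * X)
    old i i<m = begin
      letterWeight m (suc i) * continuationSum r (m ⊔ suc i) (p ++ suc i ∷ [])
        ≈⟨ *-congˡ (extended i (ℕP.<⇒≤ i<m)) ⟩
      letterWeight m (suc i) * (prefixValue (p ++ suc i ∷ []) * X)
        ≈⟨ *-assoc _ _ _ ⟨
      (letterWeight m (suc i) * prefixValue (p ++ suc i ∷ [])) * X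
        ≈⟨ *-congʳ (old-letter p i covers i<m) ⟩
      (qtTerm m i * prefixValue p) * X
        ≈⟨ *-assoc _ _ _ ⟩
      qtTerm m i * (prefixValue p * X) ∎
    new : next m ≈ (prefixValue p * (x - qtInt q t m)) * X
    new = begin
      letterWeight m (suc m) * continuationSum r (m ⊔ suc m) (p ++ suc m ∷ [])
        ≈⟨ *-congˡ (extended m ℕP.≤-refl) ⟩
      letterWeight m (suc m) * (prefixValue (p ++ suc m ∷ []) * X)
        ≈⟨ *-assoc _ _ _ ⟨
      (letterWeight m (suc m) * prefixValue (p ++ suc m ∷ [])) * X
        ≈⟨ *-congʳ (new-letter p) ⟩
      (prefixValue p * (x - qtInt q t m)) * X ∎

  covers-[1] : Covers (1 ∷ [])
  covers-[1] (suc zero)    _ _           = s≤s z≤n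
  covers-[1] (suc (suc e)) _ (s≤s ())

  no-words : ∀ n k → (∀ w → 1 ≤ maxL w × maxL w ≤ suc n → maxL w ≢ k) →
    sumList (λ w → if maxL w ≡ᵇ k then wordWeight w * falling q t x k else 0#) (rgWords (suc n)) ≈ 0#
  no-words n k ≢k =
    trans (sumList-congAll (rgWords-max n)
                           (λ w bounds → reflexive (≡.cong (λ b → if b then wordWeight w * falling q t x k else 0#)
                                                                  (≡ᵇ-false (≢k w bounds)))))
          (sumList-0 (rgWords (suc n)) (λ _ → refl))

  restrict-to-maximum : ∀ k w →
    (if inA k w then pow q (statA w) * pow t (statB w) else 0#) * falling q t x k
      ≈ (if maxL w ≡ᵇ k then wordWeight w * falling q t x k else 0#)
  restrict-to-maximum k w with maxL w ≟ k
  ... | yes ≡.refl rewrite ≡ᵇ-true (≡.refl {x = maxL w}) = refl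
  ... | no  max≢   rewrite ≡ᵇ-false max≢ = zeroˡ _

  rg-coefficient : ∀ n k → Sqt q t (suc n) k * falling q t x k
    ≈ sumList (λ w → if maxL w ≡ᵇ k then wordWeight w * falling q t x k else 0#) (rgWords (suc n))
  rg-coefficient n zero = trans (zeroˡ _) (sym (no-words n zero (λ w (1≤max , _) → ℕP.>⇒≢ 1≤max)))
  rg-coefficient n (suc k) with suc k ≤? suc n
  ... | yes k≤n rewrite ≤ᵇ-true k≤n =
    trans (sumList-*ʳ (falling q t x (suc k)) _ (rgWords (suc n))) (sumList-cong (rgWords (suc n)) (restrict-to-maximum (suc k)))

  ... | no  k≰n rewrite ≤ᵇ-false (ℕP.≰⇒> k≰n) =
    trans (zeroˡ _) (sym (no-words n (suc k) (λ w (_ , max≤n) max≡ → k≰n (≡.subst (_≤ suc n) max≡ max≤n))))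

  rg-expansion : ∀ n → pow x n ≈ sumTo n (λ k → Sqt q t n k * falling q t x k)
  rg-expansion zero    = sym (*-identityʳ 1#)
  rg-expansion (suc n) = sym (begin
    sumTo (suc n) (λ k → Sqt q t (suc n) k * falling q t x k)
      ≈⟨ sumTo≈big (suc n) _ ⟩
    Add.big (suc (suc n)) (λ k → Sqt q t (suc n) k * falling q t x k)
      ≈⟨ Add.big-cong (suc (suc n)) (λ k _ → rg-coefficient n k) ⟩
    Add.big (suc (suc n)) (λ k → sumList (λ w → if maxL w ≡ᵇ k then wordWeight w * falling q t x k else 0#)
                                         (rgWords (suc n)))
      ≈⟨ sum-by-statistic (suc n) maxL (λ k w → wordWeight w * falling q t x k) (rgWords (suc n))
                          (All.map proj₂ (rgWords-max n)) ⟩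
    sumList (λ w → wordWeight w * falling q t x (maxL w)) (rgWords (suc n))
      ≈⟨ sumList-map (λ w → wordWeight w * falling q t x (maxL w)) (1 ∷_) (rgGo n 1) ⟩
    continuationSum n 1 (1 ∷ [])
      ≈⟨ continuationSum-closed n (1 ∷ []) covers-[1] ⟩
    falling q t x 1 * pow x n
      ≈⟨ *-congʳ (trans (*-identityˡ _) (trans (+-congˡ -0#≈0#) (+-identityʳ x))) ⟩
    x * pow x n ∎)

theorem9p3 : ∀ {c ℓ} (R : CommutativeRing c ℓ) →
    let open CommutativeRing R
        open QT R
    in ∀ (q t x : Carrier) (n : ℕ) →
         (falling q t x n ≈ sumTo n (λ k → sqt q t n k * pow x k))
         × (pow x n ≈ sumTo n (λ k → Sqt q t n k * falling q t x k))
theorem9p3 R q t x n = RookExpansion.rook-expansion R q t x n , RGExpansion.rg-expansion R q t x n
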